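{- Let $n\ge 3$, let $\bar r=\langle r_1,\dots,r_m\rangle$ be a (possibly empty) strictly increasing sequence of integers in $[0,n-1]$, and let $k$ be a positive integer with $k\le n/2$. Then $\langle k;\bar r\rangle$ is a congruence of $\mathbf{L}_n$ with more than one equivalence class if and only if: (1) $r_1\ne 0$, $r_m\ne n-1$, and $r_{i+1}-r_i>1$ for all $i\in\{1,\dots,m-1\}$; (2) $k$ divides $r_i-i+1$ for all $i\in\{1,\dots,m\}$; (3) $k$ divides $n-m$.
   Context: For an integer $n\ge 0$, the line $\mathbf{L}_n$ is the frame $\langle\{0,\dots,n\},R\rangle$ where $x\mathrel{R}y$ iff $|x-y|\le 1$. A congruence of $\mathbf{L}_n$ is an equivalence relation $\theta$ on $\{0,\dots,n\}$ such that whenever $x'\mathrel{\theta}x$ and $x\mathrel{R}y$ there is $y'$ with $x'\mathrel{R}y'$ and $y'\mathrel{\theta}y$. For an integer $k\ge1$ and a (possibly empty) strictly increasing sequence $\bar r=\langle r_1,\dots,r_m\rangle$ of non-negative integers, let $\Delta_{\bar r}(x)=|\{i: r_i<x\}|$, and let $\langle k;\bar r\rangle$ be the relation on $\{0,\dots,n\}$ given by $x\,\langle k;\bar r\rangle\,y$ iff $x-\Delta_{\bar r}(x)\equiv \pm(y-\Delta_{\bar r}(y))\pmod{2k}$. Conditions (1) involving $r_1,r_m$ are vacuous when $m=0$. -}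

module Defs where

open import Data.Nat as ℕ using (ℕ; zero; suc; _≤_; _<_; _<?_; _*_; _∸_)
open import Data.Integer as ℤ using (ℤ; +_; _-_; _+_)
open import Data.Integer.Divisibility using (_∣_)
open import Data.Fin using (Fin; toℕ)
open import Data.List using (List; length; filter; allFin)
open import Data.Product using (Σ; _×_; _,_)
open import Data.Sum using (_⊎_)
open import Relation.Binary.Core using (Rel)
open import Relation.Binary.Structures using (IsEquivalence)
open import Relation.Nullary using (¬_)
open import Relation.Binary.PropositionalEquality using (_≡_; _≢_)
open import Level using (0ℓ)

Point : ℕ → Set
Point n = Fin (suc n)

LineR : (n : ℕ) → Rel (Point n) 0ℓ
LineR n x y = (toℕ x ≤ suc (toℕ y)) × (toℕ y ≤ suc (toℕ x))

record IsCongruence (n : ℕ) (θ : Rel (Point n) 0ℓ) : Set where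
  field
    isEquivalence : IsEquivalence θ
    back : ∀ x x' y → θ x' x → LineR n x y →
           Σ (Point n) (λ y' → LineR n x' y' × θ y' y)

-- A sequence r̄ = ⟨r_1,...,r_m⟩, given as r : Fin m → ℕ (r (i) is r_{i+1})
StrictlyIncreasing : {m : ℕ} → (Fin m → ℕ) → Set
StrictlyIncreasing {m} r = ∀ (i j : Fin m) → toℕ i < toℕ j → r i < r j

Δ : {m : ℕ} → (Fin m → ℕ) → ℕ → ℕ
Δ {m} r x = length (filter (λ i → r i <? x) (allFin m))

shift : {m : ℕ} → (Fin m → ℕ) → ℕ → ℤ
shift r x = + x - + Δ r x

kr : (n k : ℕ) {m : ℕ} → (Fin m → ℕ) → Rel (Point n) 0ℓ
kr n k r x y =
  ((+ (2 * k)) ∣ (shift r (toℕ x) - shift r (toℕ y)))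
  ⊎ ((+ (2 * k)) ∣ (shift r (toℕ x) + shift r (toℕ y)))

MoreThanOneClass : (n : ℕ) → Rel (Point n) 0ℓ → Set
MoreThanOneClass n θ = Σ (Point n) (λ x → Σ (Point n) (λ y → ¬ θ x y))

-- Condition (1) (1-indexed r_i is r at index i-1)
Cond1 : (n : ℕ) {m : ℕ} → (Fin m → ℕ) → Set
Cond1 n {m} r =
  (∀ (i : Fin m) → toℕ i ≡ 0 → r i ≢ 0)
  × (∀ (i : Fin m) → toℕ i ≡ m ∸ 1 → r i ≢ n ∸ 1)
  × (∀ (i j : Fin m) → toℕ j ≡ suc (toℕ i) → 1 < r j ∸ r i)

-- Condition (2): k ∣ r_i - i + 1 for i = 1..m; with 0-based index j = i - 1
-- this is k ∣ r(j) - j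
Cond2 : (k : ℕ) {m : ℕ} → (Fin m → ℕ) → Set
Cond2 k {m} r = ∀ (j : Fin m) → (+ k) ∣ (+ r j - + toℕ j)

Cond3 : (n k m : ℕ) → Set
Cond3 n k m = (+ k) ∣ (+ n - + m)

module Submission where

-- Write σ(x) = x - Δ(x) for the value that ⟨k; r̄⟩ compares (shift r x in
-- Defs), so that x ~ y iff σ(x) ≡ ±σ(y) (mod 2k).  Walking along the line,
-- σ stays put when stepping off a point of r̄ (a "hit") and increases by one
-- otherwise.  As Δ(r_i) = i - 1 and Δ(n) = m, conditions (2) and (3) say
-- that k divides σ at every hit and at n.  The proof is organised around
-- three facts about a point x:
--   * If all neighbours of x have the value of x ("flat" point), the back
--     condition forces every point into the class of x.  Flat points arise
--     exactly when r₁ = 0, r_m = n-1 or two hits are adjacent, so for a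
--     congruence with two classes condition (1) holds ("sparse" hits).
--   * If all neighbours of x have values in {σ(x), σ(x)+e} (e = ±1) while
--     some point of the class of x has a neighbour of value ≡ ±(σ(x)-e),
--     then the back condition yields σ(x)+e ≡ ±(σ(x)-e), i.e. k ∣ σ(x).
--     Applied to the successor of a hit and to the endpoint n (using a
--     discrete intermediate value theorem to find the required points, and
--     σ(n) ≥ k from sparseness) this gives conditions (2) and (3).
--   * Conversely, under (1)-(3) every point has a neighbour of value
--     ≡ ±(σ(x)+1) and one of value ≡ ±(σ(x)-1), which is exactly what the
--     back condition needs; the points 0 and 1 lie in different classes.

open import Defs
open import Data.Nat as ℕ using (ℕ; zero; suc; _≤_; _<_; z≤n; s≤s; z<s; _<?_; _≟_)
open import Data.Nat.Properties
import Data.Nat.Divisibility as ℕ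
open import Data.Integer as ℤ using (ℤ; +_; -_; -[1+_])
import Data.Integer.Properties as ℤP
open import Data.Integer.Divisibility.Signed as Signed using (divides)
open import Data.Integer.Tactic.RingSolver using (solve-∀)
open import Data.Fin using (Fin; toℕ; fromℕ<)
  renaming (zero to fzero; suc to fsuc)
open import Data.Fin.Properties using (any?; toℕ<n; toℕ≤pred[n]; toℕ-fromℕ<; toℕ-injective)
open import Data.List using (List; []; _∷_; length; filter; map; tabulate; allFin)
open import Data.List.Properties
  using (map-tabulate; length-tabulate; filter-accept; filter-reject; filter-all; filter-none)
open import Data.List.Relation.Unary.All.Properties using (tabulate⁺)
open import Data.Product using (Σ; _×_; _,_; proj₁; proj₂)
open import Data.Sum using (_⊎_; inj₁; inj₂)
open import Data.Empty using (⊥-elim)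
open import Data.Bool using (true; false)
open import Function using (_∘_)
open import Function.Bundles using (_⇔_; mk⇔)
open import Relation.Nullary using (¬_; Dec; yes; no; does; contradiction)
open import Relation.Unary using (Decidable)
open import Relation.Binary.PropositionalEquality
open import Relation.Binary.Definitions using (tri<; tri≈; tri>)

Unit : ℤ → Set
Unit e = ℤ.∣ e ∣ ≡ 1

unit-neg : ∀ {e} → Unit e → Unit (- e)
unit-neg {e} u = trans (ℤP.∣-i∣≡∣i∣ e) u

unit-∣ : ∀ {e} a → Unit e → e Signed.∣ a
unit-∣ {e} a u = Signed.∣ᵤ⇒∣ (subst (ℕ._∣ ℤ.∣ a ∣) (sym u) (ℕ.1∣ ℤ.∣ a ∣))

unit-odd : ∀ {e} → Unit e → ¬ (+ 2 Signed.∣ e)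
unit-odd u 2∣e with ℕ.∣⇒≤ (subst (2 ℕ.∣_) u (Signed.∣⇒∣ᵤ 2∣e))
... | s≤s ()

module PlusMinus (k : ℕ) where
  open import Data.Integer using (_+_; _-_; _*_)

  infix 4 _≡±_
  data _≡±_ (a b : ℤ) : Set where
    same     : + (2 ℕ.* k) Signed.∣ a - b → a ≡± b
    opposite : + (2 ℕ.* k) Signed.∣ a + b → a ≡± b

  2k≡2*k : + (2 ℕ.* k) ≡ + 2 * + k
  2k≡2*k = ℤP.pos-* 2 k

  2∣2k : + 2 Signed.∣ + (2 ℕ.* k)
  2∣2k = divides (+ k) (trans 2k≡2*k (ℤP.*-comm (+ 2) (+ k)))

  halve : ∀ {a} → + (2 ℕ.* k) Signed.∣ + 2 * a → + k Signed.∣ a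
  halve 2k∣2a = Signed.*-cancelˡ-∣ (+ 2) (subst (Signed._∣ _) 2k≡2*k 2k∣2a)

  double : ∀ {a} → + k Signed.∣ a → + (2 ℕ.* k) Signed.∣ + 2 * a
  double k∣a = subst (Signed._∣ _) (sym 2k≡2*k) (Signed.*-monoʳ-∣ (+ 2) k∣a)

  ≡±-reflexive : ∀ {a b} → a ≡ b → a ≡± b
  ≡±-reflexive {a} refl = same (divides (+ 0) (ℤP.+-inverseʳ a))

  ≡±-refl : ∀ {a} → a ≡± a
  ≡±-refl {a} = ≡±-reflexive {a} refl

  ≡±-sym : ∀ {a b} → a ≡± b → b ≡± a
  ≡±-sym {a} {b} (same d) = same (subst (Signed._∣_ _) (negate a b) (Signed.∣m⇒∣-m d))
    where
    negate : ∀ a b → - (a - b) ≡ b - a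
    negate = solve-∀
  ≡±-sym {a} {b} (opposite d) = opposite (subst (Signed._∣_ _) (ℤP.+-comm a b) d)

  ≡±-trans : ∀ {a b c} → a ≡± b → b ≡± c → a ≡± c
  ≡±-trans {a} {b} {c} (same d) (same d') = same (subst (Signed._∣_ _) (eq a b c) (Signed.∣m∣n⇒∣m+n d d'))
    where
    eq : ∀ a b c → (a - b) + (b - c) ≡ a - c
    eq = solve-∀
  ≡±-trans {a} {b} {c} (same d) (opposite d') =
    opposite (subst (Signed._∣_ _) (eq a b c) (Signed.∣m∣n⇒∣m+n d d'))
    where
    eq : ∀ a b c → (a - b) + (b + c) ≡ a + c
    eq = solve-∀
  ≡±-trans {a} {b} {c} (opposite d) (same d') =
    opposite (subst (Signed._∣_ _) (eq a b c) (Signed.∣m∣n⇒∣m-n d d'))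
    where
    eq : ∀ a b c → (a + b) - (b - c) ≡ a + c
    eq = solve-∀
  ≡±-trans {a} {b} {c} (opposite d) (opposite d') =
    same (subst (Signed._∣_ _) (eq a b c) (Signed.∣m∣n⇒∣m-n d d'))
    where
    eq : ∀ a b c → (a + b) - (b + c) ≡ a - c
    eq = solve-∀

  ≡±⇒even : ∀ {a b} → a ≡± b → + 2 Signed.∣ a - b
  ≡±⇒even (same d) = Signed.∣-trans 2∣2k d
  ≡±⇒even {a} {b} (opposite d) =
    subst (Signed._∣_ _) (eq a b) (Signed.∣m∣n⇒∣m-n (Signed.∣-trans 2∣2k d) (divides b refl))
    where
    eq : ∀ a b → (a + b) - b * + 2 ≡ a - b
    eq = solve-∀

  ≢±-adjacent : ∀ {a e} → Unit e → ¬ (a ≡± a + e)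
  ≢±-adjacent {a} {e} u a≡±a+e =
    unit-odd (unit-neg {e} u) (subst (Signed._∣_ _) (eq a e) (≡±⇒even {a} {a + e} a≡±a+e))
    where
    eq : ∀ a e → a - (a + e) ≡ - e
    eq = solve-∀

  ±unit⇒∣ : ∀ {a e} → Unit e → a + e ≡± a - e → + k Signed.∣ a
  ±unit⇒∣ {a} {e} u (same d) =
    Signed.∣-trans (halve (subst (Signed._∣_ _) (eq a e) d)) (unit-∣ a u)
    where
    eq : ∀ a e → (a + e) - (a - e) ≡ + 2 * e
    eq = solve-∀
  ±unit⇒∣ {a} {e} u (opposite d) = halve (subst (Signed._∣_ _) (eq a e) d)
    where
    eq : ∀ a e → (a + e) + (a - e) ≡ + 2 * a
    eq = solve-∀

  ≡±-one-sided : ∀ {a b e} → Unit e → b ≡± a - e → b ≡ a ⊎ b ≡ a + e → + k Signed.∣ a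
  ≡±-one-sided {a} {e = e} u b≡±a-e (inj₁ refl) = ⊥-elim (≢±-adjacent {a} { - e} (unit-neg {e} u) b≡±a-e)
  ≡±-one-sided u b≡±a-e (inj₂ refl) = ±unit⇒∣ u b≡±a-e

  ∣⇒±unit : ∀ {a} e → + k Signed.∣ a → a + e ≡± a - e
  ∣⇒±unit {a} e k∣a = opposite (subst (Signed._∣_ _) (sym (eq a e)) (double k∣a))
    where
    eq : ∀ a e → (a + e) + (a - e) ≡ + 2 * a
    eq = solve-∀

  ≡±-translate : ∀ {a b} c → a ≡± b → (a + c ≡± b + c) ⊎ (a - c ≡± b + c)
  ≡±-translate {a} {b} c (same d) = inj₁ (same (subst (Signed._∣_ _) (eq a b c) d))
    where
    eq : ∀ a b c → a - b ≡ (a + c) - (b + c)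
    eq = solve-∀
  ≡±-translate {a} {b} c (opposite d) = inj₂ (opposite (subst (Signed._∣_ _) (eq a b c) d))
    where
    eq : ∀ a b c → a + b ≡ (a - c) + (b + c)
    eq = solve-∀

  ≡±-apart : ∀ {a b} → a ℕ.+ 2 ℕ.* k ≡ b → + a ≡± + b
  ≡±-apart {a} refl = same (divides (- + 1) (eq (+ a) (+ (2 ℕ.* k))))
    where
    eq : ∀ a K → a - (a + K) ≡ (- + 1) * K
    eq = solve-∀

  ≡±-mirror : ∀ {a b} → a ℕ.+ b ≡ 2 ℕ.* k → + a ≡± + b
  ≡±-mirror a+b≡2k = opposite (divides (+ 1) (trans (cong +_ a+b≡2k) (sym (ℤP.*-identityˡ _))))

open import Data.Nat using (_+_; _*_; _∸_)

count-map : ∀ {A B : Set} {P : B → Set} (P? : Decidable P) (f : A → B) (xs : List A) →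
            length (filter P? (map f xs)) ≡ length (filter (λ a → P? (f a)) xs)
count-map P? f [] = refl
count-map P? f (x ∷ xs) with does (P? (f x))
... | true  = cong suc (count-map P? f xs)
... | false = count-map P? f xs

Δ-tail : ∀ {m} (r : Fin (suc m) → ℕ) x →
         length (filter (λ i → r i <? x) (tabulate fsuc)) ≡ Δ (r ∘ fsuc) x
Δ-tail {m} r x =
  trans (cong (length ∘ filter (λ i → r i <? x)) (sym (map-tabulate (λ i → i) fsuc)))
        (count-map (λ i → r i <? x) fsuc (allFin m))

Δ-head-below : ∀ {m} (r : Fin (suc m) → ℕ) {x} → r fzero < x → Δ r x ≡ suc (Δ (r ∘ fsuc) x)
Δ-head-below r {x} r₁<x = trans (cong length (filter-accept (λ i → r i <? x) r₁<x)) (cong suc (Δ-tail r x))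

Δ-head-above : ∀ {m} (r : Fin (suc m) → ℕ) {x} → ¬ r fzero < x → Δ r x ≡ Δ (r ∘ fsuc) x
Δ-head-above r {x} r₁≮x = trans (cong length (filter-reject (λ i → r i <? x) r₁≮x)) (Δ-tail r x)

Δ-none : ∀ {m} (r : Fin m → ℕ) {x} → (∀ i → x ≤ r i) → Δ r x ≡ 0
Δ-none r {x} x≤r = cong length (filter-none (λ i → r i <? x) (tabulate⁺ (λ i → ≤⇒≯ (x≤r i))))

Δ-all : ∀ {m} (r : Fin m → ℕ) {x} → (∀ i → r i < x) → Δ r x ≡ m
Δ-all {m} r {x} r<x =
  trans (cong length (filter-all (λ i → r i <? x) (tabulate⁺ r<x))) (length-tabulate (λ i → i))

Δ-miss : ∀ {m} (r : Fin m → ℕ) {x} → (∀ i → r i ≢ x) → Δ r (suc x) ≡ Δ r x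
Δ-miss {zero} r r≢x = refl
Δ-miss {suc m} r {x} r≢x with r fzero <? x
... | yes r₁<x = begin
  Δ r (suc x)                 ≡⟨ Δ-head-below r (m<n⇒m<1+n r₁<x) ⟩
  suc (Δ (r ∘ fsuc) (suc x))  ≡⟨ cong suc (Δ-miss (r ∘ fsuc) (r≢x ∘ fsuc)) ⟩
  suc (Δ (r ∘ fsuc) x)        ≡⟨ Δ-head-below r r₁<x ⟨
  Δ r x                       ∎
  where open ≡-Reasoning
... | no r₁≮x = begin
  Δ r (suc x)                 ≡⟨ Δ-head-above r r₁≮1+x ⟩
  Δ (r ∘ fsuc) (suc x)        ≡⟨ Δ-miss (r ∘ fsuc) (r≢x ∘ fsuc) ⟩
  Δ (r ∘ fsuc) x              ≡⟨ Δ-head-above r r₁≮x ⟨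
  Δ r x                       ∎
  where
  open ≡-Reasoning
  r₁≮1+x : ¬ r fzero < suc x
  r₁≮1+x r₁<1+x = r₁≮x (≤∧≢⇒< (≤-pred r₁<1+x) (r≢x fzero))

StrictlyIncreasing-tail : ∀ {m} {r : Fin (suc m) → ℕ} →
                          StrictlyIncreasing r → StrictlyIncreasing (r ∘ fsuc)
StrictlyIncreasing-tail inc i j i<j = inc (fsuc i) (fsuc j) (s≤s i<j)

Δ-at : ∀ {m} (r : Fin m → ℕ) → StrictlyIncreasing r → ∀ j → Δ r (r j) ≡ toℕ j
Δ-at r inc fzero =
  trans (Δ-head-above r (<-irrefl refl)) (Δ-none (r ∘ fsuc) (λ i → <⇒≤ (inc fzero (fsuc i) z<s)))
Δ-at r inc (fsuc j) =
  trans (Δ-head-below r (inc fzero (fsuc j) z<s))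
        (cong suc (Δ-at (r ∘ fsuc) (StrictlyIncreasing-tail inc) j))

Δ-hit : ∀ {m} (r : Fin m → ℕ) → StrictlyIncreasing r → ∀ j → Δ r (suc (r j)) ≡ suc (Δ r (r j))
Δ-hit r inc fzero = begin
  Δ r (suc (r fzero))                ≡⟨ Δ-head-below r (n<1+n (r fzero)) ⟩
  suc (Δ (r ∘ fsuc) (suc (r fzero))) ≡⟨ cong suc (Δ-miss (r ∘ fsuc) (λ i → >⇒≢ (inc fzero (fsuc i) z<s))) ⟩
  suc (Δ (r ∘ fsuc) (r fzero))       ≡⟨ cong suc (Δ-head-above r (<-irrefl refl)) ⟨
  suc (Δ r (r fzero))                ∎
  where open ≡-Reasoning
Δ-hit r inc (fsuc j) = begin
  Δ r (suc (r (fsuc j)))                ≡⟨ Δ-head-below r (m<n⇒m<1+n r₁<rⱼ) ⟩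
  suc (Δ (r ∘ fsuc) (suc (r (fsuc j)))) ≡⟨ cong suc (Δ-hit (r ∘ fsuc) (StrictlyIncreasing-tail inc) j) ⟩
  suc (suc (Δ (r ∘ fsuc) (r (fsuc j)))) ≡⟨ cong suc (Δ-head-below r r₁<rⱼ) ⟨
  suc (Δ r (r (fsuc j)))                ∎
  where
  open ≡-Reasoning
  r₁<rⱼ : r fzero < r (fsuc j)
  r₁<rⱼ = inc fzero (fsuc j) z<s

Adj : ℕ → ℕ → Set
Adj x y = x ≤ suc y × y ≤ suc x

adj-refl : ∀ x → Adj x x
adj-refl x = n≤1+n x , n≤1+n x

adj-right : ∀ x → Adj x (suc x)
adj-right x = m≤n⇒m≤1+n (n≤1+n x) , ≤-refl

adj-left : ∀ x → Adj (suc x) x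
adj-left x = ≤-refl , m≤n⇒m≤1+n (n≤1+n x)

adj-cases : ∀ {x y} → Adj x y → y ≡ x ⊎ y ≡ suc x ⊎ suc y ≡ x
adj-cases {x} {y} (x≤1+y , y≤1+x) with <-cmp x y
... | tri< x<y _ _ = inj₂ (inj₁ (≤-antisym y≤1+x x<y))
... | tri≈ _ x≡y _ = inj₁ (sym x≡y)
... | tri> _ _ y<x = inj₂ (inj₂ (≤-antisym y<x x≤1+y))

line-connected : ∀ n (P : ℕ → Set) {p} → p ≤ n → P p →
                 (∀ x y → x ≤ n → y ≤ n → Adj x y → P x → P y) →
                 ∀ x → x ≤ n → P x
line-connected n P {p} p≤n Pp carry = upward
  where
  downward : ∀ d x → x + d ≡ p → P x
  downward zero x x+0≡p = subst P (trans (sym x+0≡p) (+-identityʳ x)) Pp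
  downward (suc d) x x+1+d≡p =
    carry (suc x) x 1+x≤n (<⇒≤ 1+x≤n) (adj-left x) (downward d (suc x) (trans (sym (+-suc x d)) x+1+d≡p))
    where
    1+x≤n : suc x ≤ n
    1+x≤n = ≤-trans (≤-trans (s≤s (m≤m+n x d)) (≤-reflexive (trans (sym (+-suc x d)) x+1+d≡p))) p≤n
  upward : ∀ x → x ≤ n → P x
  upward zero    _      = downward p 0 refl
  upward (suc x) 1+x≤n = carry x (suc x) (<⇒≤ 1+x≤n) 1+x≤n (adj-right x) (upward x (<⇒≤ 1+x≤n))

discrete-ivt : (f : ℕ → ℕ) → (∀ x → f (suc x) ≤ suc (f x)) →
               ∀ {t} x → f 0 ≤ t → t < f x →
               Σ ℕ λ z → z < x × f z ≡ t × f (suc z) ≡ suc t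
discrete-ivt f slow zero f0≤t t<f0 = ⊥-elim (<⇒≱ t<f0 f0≤t)
discrete-ivt f slow {t} (suc x) f0≤t t<fx+1 with t <? f x
... | yes t<fx = let (z , z<x , fz≡t , fz+1≡1+t) = discrete-ivt f slow x f0≤t t<fx
                 in z , m<n⇒m<1+n z<x , fz≡t , fz+1≡1+t
... | no t≮fx = x , n<1+n x , fx≡t , ≤-antisym (subst (λ v → f (suc x) ≤ suc v) fx≡t (slow x)) t<fx+1
  where
  fx≡t : f x ≡ t
  fx≡t = ≤-antisym (≮⇒≥ t≮fx) (≤-pred (≤-trans t<fx+1 (slow x)))

module Line (n : ℕ) {m : ℕ} (r : Fin m → ℕ) (inc : StrictlyIncreasing r) (r<n : ∀ i → r i < n) where

  Hit : ℕ → Set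
  Hit x = Σ (Fin m) λ i → r i ≡ x

  hit? : ∀ x → Dec (Hit x)
  hit? x = any? (λ i → r i ≟ x)

  hit<n : ∀ {x} → Hit x → x < n
  hit<n (i , refl) = r<n i

  Δ-across-hit : ∀ {x} → Hit x → Δ r (suc x) ≡ suc (Δ r x)
  Δ-across-hit (j , refl) = Δ-hit r inc j

  Δ-across-miss : ∀ {x} → ¬ Hit x → Δ r (suc x) ≡ Δ r x
  Δ-across-miss ¬hit = Δ-miss r (λ i rᵢ≡x → ¬hit (i , rᵢ≡x))

  shift-hit : ∀ {x} → Hit x → shift r (suc x) ≡ shift r x
  shift-hit {x} hit rewrite Δ-across-hit hit = step (+ x) (+ Δ r x)
    where
    step : ∀ a b → (+ 1 ℤ.+ a) ℤ.- (+ 1 ℤ.+ b) ≡ a ℤ.- b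
    step = solve-∀

  shift-miss : ∀ {x} → ¬ Hit x → shift r (suc x) ≡ shift r x ℤ.+ + 1
  shift-miss {x} ¬hit rewrite Δ-across-miss ¬hit = step (+ x) (+ Δ r x)
    where
    step : ∀ a b → (+ 1 ℤ.+ a) ℤ.- b ≡ (a ℤ.- b) ℤ.+ + 1
    step = solve-∀

  shift-miss⁻ : ∀ {x} → ¬ Hit x → shift r x ≡ shift r (suc x) ℤ.+ - + 1
  shift-miss⁻ {x} ¬hit = trans (step (shift r x)) (cong (ℤ._+ - + 1) (sym (shift-miss ¬hit)))
    where
    step : ∀ a → a ≡ (a ℤ.+ + 1) ℤ.+ - + 1
    step = solve-∀

  shift-zero : shift r 0 ≡ + 0
  shift-zero rewrite Δ-none r {0} (λ _ → z≤n) = refl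

  step-value : ∀ {x y} → Adj x y →
               shift r y ≡ shift r x ⊎ Σ ℤ λ e → Unit e × shift r y ≡ shift r x ℤ.+ e
  step-value adj with adj-cases adj
  ... | inj₁ refl = inj₁ refl
  ... | inj₂ (inj₁ refl) with hit? _
  ...   | yes hit = inj₁ (shift-hit hit)
  ...   | no ¬hit = inj₂ (+ 1 , refl , shift-miss ¬hit)
  step-value adj | inj₂ (inj₂ refl) with hit? _
  ...   | yes hit = inj₁ (sym (shift-hit hit))
  ...   | no ¬hit = inj₂ (- + 1 , refl , shift-miss⁻ ¬hit)

  σ : ℕ → ℕ
  σ x = x ∸ Δ r x

  Δ≤ : ∀ x → Δ r x ≤ x
  Δ≤ zero = ≤-reflexive (Δ-none r (λ _ → z≤n))
  Δ≤ (suc x) with hit? x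
  ... | yes hit  rewrite Δ-across-hit hit  = s≤s (Δ≤ x)
  ... | no ¬hit rewrite Δ-across-miss ¬hit = m≤n⇒m≤1+n (Δ≤ x)

  shift-σ : ∀ x → shift r x ≡ + σ x
  shift-σ x = trans (ℤP.m-n≡m⊖n x (Δ r x)) (ℤP.⊖-≥ (Δ≤ x))

  value : ∀ x {v} → σ x ≡ v → shift r x ≡ + v
  value x σx≡v = trans (shift-σ x) (cong +_ σx≡v)

  σ-zero : σ 0 ≡ 0
  σ-zero = 0∸n≡0 (Δ r 0)

  σ-hit : ∀ {x} → Hit x → σ (suc x) ≡ σ x
  σ-hit hit rewrite Δ-across-hit hit = refl

  σ-miss : ∀ {x} → ¬ Hit x → σ (suc x) ≡ suc (σ x)
  σ-miss {x} ¬hit rewrite Δ-across-miss ¬hit = +-∸-assoc 1 (Δ≤ x)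

  σ-increment : ∀ x → σ (suc x) ≡ σ x ⊎ σ (suc x) ≡ suc (σ x)
  σ-increment x with hit? x
  ... | yes hit = inj₁ (σ-hit hit)
  ... | no ¬hit = inj₂ (σ-miss ¬hit)

  σ-slow : ∀ x → σ (suc x) ≤ suc (σ x)
  σ-slow x with σ-increment x
  ... | inj₁ stays = ≤-trans (≤-reflexive stays) (n≤1+n (σ x))
  ... | inj₂ rises = ≤-reflexive rises

  σ-mono : ∀ {x y} → x ≤ y → σ x ≤ σ y
  σ-mono {x} {y} x≤y = subst (λ v → σ x ≤ σ v) (m∸n+n≡m x≤y) (climb (y ∸ x))
    where
    climb : ∀ d → σ x ≤ σ (d + x)
    climb zero = ≤-refl
    climb (suc d) with σ-increment (d + x)
    ... | inj₁ stays = ≤-trans (climb d) (≤-reflexive (sym stays))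
    ... | inj₂ rises = ≤-trans (climb d) (≤-trans (n≤1+n _) (≤-reflexive (sym rises)))

  σ-ivt : ∀ {t} x → t < σ x → Σ ℕ λ z → z < x × σ z ≡ t × σ (suc z) ≡ suc t
  σ-ivt x t<σx = discrete-ivt σ σ-slow x (≤-trans (≤-reflexive σ-zero) z≤n) t<σx

  shift-at : ∀ j → shift r (r j) ≡ + r j ℤ.- + toℕ j
  shift-at j = cong (λ d → + r j ℤ.- + d) (Δ-at r inc j)

  shift-end : shift r n ≡ + n ℤ.- + m
  shift-end = cong (λ d → + n ℤ.- + d) (Δ-all r r<n)

  Flat : ℕ → Set
  Flat p = ∀ y → y ≤ n → Adj p y → shift r y ≡ shift r p

  flat-between : ∀ p → (∀ y → suc y ≡ p → Hit y) → (p < n → Hit p) → Flat p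
  flat-between p hit-before hit-at y y≤n adj with adj-cases adj
  ... | inj₁ refl        = refl
  ... | inj₂ (inj₁ refl) = shift-hit (hit-at y≤n)
  ... | inj₂ (inj₂ refl) = sym (shift-hit (hit-before y refl))

  record Sparse : Set where
    field
      first-free : ¬ Hit 0
      last-free  : ∀ y → suc y ≡ n → ¬ Hit y
      isolated   : ∀ x → Hit x → ¬ Hit (suc x)

  -- With isolated hits σ rises at least once every two steps, so σ (2j) ≥ j.
  σ-lower : (∀ x → Hit x → ¬ Hit (suc x)) → ∀ j → j ≤ σ (j * 2)
  σ-lower isolated zero    = z≤n
  σ-lower isolated (suc j) = ≤-trans (s≤s (σ-lower isolated j)) (two-steps (j * 2))
    where
    two-steps : ∀ x → suc (σ x) ≤ σ (suc (suc x))
    two-steps x with hit? x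
    ... | yes hit = ≤-reflexive (sym (trans (σ-miss (isolated x hit)) (cong suc (σ-hit hit))))
    ... | no ¬hit = ≤-trans (≤-reflexive (sym (σ-miss ¬hit))) (σ-mono (n≤1+n (suc x)))

  r-mono : ∀ i j → toℕ i ≤ toℕ j → r i ≤ r j
  r-mono i j i≤j with m≤n⇒m<n∨m≡n i≤j
  ... | inj₁ i<j = <⇒≤ (inc i j i<j)
  ... | inj₂ i≡j = ≤-reflexive (cong r (toℕ-injective i≡j))

  index-order : ∀ i j → r i < r j → toℕ i < toℕ j
  index-order i j rᵢ<rⱼ with toℕ i <? toℕ j
  ... | yes i<j = i<j
  ... | no i≮j  = contradiction (r-mono j i (≮⇒≥ i≮j)) (<⇒≱ rᵢ<rⱼ)

  next-index : (i : Fin m) → suc (toℕ i) < m → Σ (Fin m) λ j → toℕ j ≡ suc (toℕ i)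
  next-index i 1+i<m = fromℕ< 1+i<m , toℕ-fromℕ< 1+i<m

  sparse⇒cond1 : Sparse → Cond1 n r
  sparse⇒cond1 sparse = first , last , gaps
    where
    open Sparse sparse
    first : ∀ i → toℕ i ≡ 0 → r i ≢ 0
    first i _ rᵢ≡0 = first-free (i , rᵢ≡0)
    last : ∀ i → toℕ i ≡ m ∸ 1 → r i ≢ n ∸ 1
    last i _ rᵢ≡n-1 = last-free (n ∸ 1) (m+[n∸m]≡n (≤-trans (s≤s z≤n) (r<n i))) (i , rᵢ≡n-1)
    gaps : ∀ i j → toℕ j ≡ suc (toℕ i) → 1 < r j ∸ r i
    gaps i j j≡1+i = m+n≤o⇒m≤o∸n 2 (≤∧≢⇒< rᵢ<rⱼ (λ e → isolated (r i) (i , refl) (j , sym e)))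
      where
      rᵢ<rⱼ : r i < r j
      rᵢ<rⱼ = inc i j (≤-reflexive (sym j≡1+i))

  cond1⇒sparse : Cond1 n r → Sparse
  cond1⇒sparse (first , last , gaps) = record
    { first-free = first-free ; last-free = last-free ; isolated = isolated }
    where
    first-free : ¬ Hit 0
    first-free (fzero , r₁≡0)  = first fzero refl r₁≡0
    first-free (fsuc i , rᵢ≡0) = n≮0 (subst (r fzero <_) rᵢ≡0 (inc fzero (fsuc i) z<s))

    last-free : ∀ y → suc y ≡ n → ¬ Hit y
    last-free y 1+y≡n (i , rᵢ≡y) with toℕ i ≟ m ∸ 1
    ... | yes i-last = last i i-last (trans rᵢ≡y (cong (_∸ 1) 1+y≡n))
    ... | no ¬i-last = <-irrefl 1+y≡n (≤-<-trans y<rⱼ (r<n j))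
      where
      1+i<m : suc (toℕ i) < m
      1+i<m = ≤∧≢⇒< (toℕ<n i) (λ e → ¬i-last (cong (_∸ 1) e))
      j : Fin m
      j = proj₁ (next-index i 1+i<m)
      y<rⱼ : y < r j
      y<rⱼ = subst (_< r j) rᵢ≡y (inc i j (≤-reflexive (sym (proj₂ (next-index i 1+i<m)))))

    -- the entry after r_i is at least r_i + 2, yet not beyond r_j = r_i + 1
    isolated : ∀ x → Hit x → ¬ Hit (suc x)
    isolated x (i , rᵢ≡x) (j , rⱼ≡1+x) = 1+n≰n (≤-trans gap (≤-trans rₗ≤rⱼ (≤-reflexive rⱼ≡1+rᵢ)))
      where
      rⱼ≡1+rᵢ : r j ≡ suc (r i)
      rⱼ≡1+rᵢ = trans rⱼ≡1+x (cong suc (sym rᵢ≡x))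
      i<j : toℕ i < toℕ j
      i<j = index-order i j (≤-reflexive (sym rⱼ≡1+rᵢ))
      l : Fin m
      l = proj₁ (next-index i (≤-<-trans i<j (toℕ<n j)))
      l≡1+i : toℕ l ≡ suc (toℕ i)
      l≡1+i = proj₂ (next-index i (≤-<-trans i<j (toℕ<n j)))
      rₗ≤rⱼ : r l ≤ r j
      rₗ≤rⱼ = r-mono l j (subst (_≤ toℕ j) (sym l≡1+i) i<j)
      gap : suc (suc (r i)) ≤ r l
      gap = subst (2 + r i ≤_) (m∸n+n≡m (<⇒≤ (inc i l (≤-reflexive (sym l≡1+i)))))
                  (+-monoˡ-≤ (r i) (gaps i l l≡1+i))

  module Relation (k : ℕ) where
    open PlusMinus k

    infix 4 _~_
    _~_ : ℕ → ℕ → Set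
    x ~ y = shift r x ≡± shift r y

    ~-refl : ∀ x → x ~ x
    ~-refl x = ≡±-refl {shift r x}

    ~-sym : ∀ {x y} → x ~ y → y ~ x
    ~-sym {x} {y} = ≡±-sym {shift r x} {shift r y}

    ~-trans : ∀ {x y z} → x ~ y → y ~ z → x ~ z
    ~-trans {x} {y} {z} = ≡±-trans {shift r x} {shift r y} {shift r z}

    kr⇒~ : ∀ {a b} → kr n k r a b → toℕ a ~ toℕ b
    kr⇒~ (inj₁ d) = same (Signed.∣ᵤ⇒∣ d)
    kr⇒~ (inj₂ d) = opposite (Signed.∣ᵤ⇒∣ d)

    ~⇒kr : ∀ {a b} → toℕ a ~ toℕ b → kr n k r a b
    ~⇒kr (same d)     = inj₁ (Signed.∣⇒∣ᵤ d)
    ~⇒kr (opposite d) = inj₂ (Signed.∣⇒∣ᵤ d)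

    as-point : ∀ {x} → x ≤ n → Σ (Point n) λ a → toℕ a ≡ x
    as-point x≤n = fromℕ< (s≤s x≤n) , toℕ-fromℕ< (s≤s x≤n)

    Back : Set
    Back = ∀ x x' y → x ≤ n → x' ≤ n → y ≤ n → x' ~ x → Adj x y →
           Σ ℕ λ y' → y' ≤ n × Adj x' y' × y' ~ y

    congruence⇒back : IsCongruence n (kr n k r) → Back
    congruence⇒back C x x' y x≤n x'≤n y≤n x'~x adj
      with as-point x≤n | as-point x'≤n | as-point y≤n
    ... | a , refl | a' , refl | b , refl with IsCongruence.back C a a' b (~⇒kr x'~x) adj
    ... | b' , adj' , b'θb = toℕ b' , toℕ≤pred[n] b' , adj' , kr⇒~ b'θb

    back⇒congruence : Back → IsCongruence n (kr n k r)
    back⇒congruence back = record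
      { isEquivalence = record
        { refl  = λ {a} → ~⇒kr {a} {a} (~-refl (toℕ a))
        ; sym   = λ {a} {b} aθb → ~⇒kr {b} {a} (~-sym (kr⇒~ {a} {b} aθb))
        ; trans = λ {a} {b} {c} aθb bθc →
            ~⇒kr {a} {c} (~-trans (kr⇒~ {a} {b} aθb) (kr⇒~ {b} {c} bθc))
        }
      ; back = back-point
      }
      where
      back-point : ∀ a a' b → kr n k r a' a → LineR n a b →
                   Σ (Point n) λ b' → LineR n a' b' × kr n k r b' b
      back-point a a' b a'θa adj
        with back (toℕ a) (toℕ a') (toℕ b) (toℕ≤pred[n] a) (toℕ≤pred[n] a') (toℕ≤pred[n] b) (kr⇒~ a'θa) adj
      ... | y' , y'≤n , adj' , y'~b with as-point y'≤n
      ... | b' , refl = b' , adj' , ~⇒kr {b'} {b} y'~b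

    cond2⇒hits-divisible : Cond2 k r → ∀ x → Hit x → + k Signed.∣ shift r x
    cond2⇒hits-divisible c2 x (j , refl) = subst (+ k Signed.∣_) (sym (shift-at j)) (Signed.∣ᵤ⇒∣ (c2 j))

    hits-divisible⇒cond2 : (∀ x → Hit x → + k Signed.∣ shift r x) → Cond2 k r
    hits-divisible⇒cond2 k∣hit j = Signed.∣⇒∣ᵤ (subst (+ k Signed.∣_) (shift-at j) (k∣hit (r j) (j , refl)))

    cond3⇒end-divisible : Cond3 n k m → + k Signed.∣ shift r n
    cond3⇒end-divisible c3 = subst (+ k Signed.∣_) (sym shift-end) (Signed.∣ᵤ⇒∣ c3)

    end-divisible⇒cond3 : + k Signed.∣ shift r n → Cond3 n k m
    end-divisible⇒cond3 k∣end = Signed.∣⇒∣ᵤ (subst (+ k Signed.∣_) shift-end k∣end)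

    flat-collapses : Back → ∀ {p} → p ≤ n → Flat p → ∀ x → x ≤ n → x ~ p
    flat-collapses back {p} p≤n flat = line-connected n (_~ p) p≤n (~-refl p) spread
      where
      spread : ∀ x y → x ≤ n → y ≤ n → Adj x y → x ~ p → y ~ p
      spread x y x≤n y≤n adj x~p with back x p y x≤n p≤n y≤n (~-sym x~p) adj
      ... | y' , y'≤n , adj' , y'~y = ~-trans (~-sym y'~y) (≡±-reflexive (flat y' y'≤n adj'))

    -- So with two classes there is no flat point, which rules out a hit at 0,
    -- a hit at n - 1 and two adjacent hits.
    sparse-hits : Back → MoreThanOneClass n (kr n k r) → Sparse
    sparse-hits back (a , b , ¬aθb) = record
      { first-free = λ hit → no-flat z≤n (flat-between 0 (λ _ ()) (λ _ → hit))
      ; last-free  = λ y 1+y≡n hit →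
          no-flat ≤-refl (flat-between n (before y 1+y≡n hit) (λ n<n → ⊥-elim (<-irrefl refl n<n)))
      ; isolated   = λ x hit hit' →
          no-flat (<⇒≤ (hit<n hit')) (flat-between (suc x) (before x refl hit) (λ _ → hit'))
      }
      where
      no-flat : ∀ {p} → p ≤ n → ¬ Flat p
      no-flat {p} p≤n flat = ¬aθb (~⇒kr {a} {b} (~-trans (collapse a) (~-sym (collapse b))))
        where
        collapse : ∀ c → toℕ c ~ p
        collapse c = flat-collapses back p≤n flat (toℕ c) (toℕ≤pred[n] c)
      -- a point has only one predecessor
      before : ∀ y {p} → suc y ≡ p → Hit y → ∀ y' → suc y' ≡ p → Hit y'
      before y 1+y≡p hit y' 1+y'≡p = subst Hit (suc-injective (trans 1+y≡p (sym 1+y'≡p))) hit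

    OneSided : ℕ → ℤ → Set
    OneSided p e = ∀ y → y ≤ n → Adj p y → shift r y ≡ shift r p ⊎ shift r y ≡ shift r p ℤ.+ e

    -- If a point v of the class of a one-sided point p has a neighbour w whose
    -- value is related to shift p - e, the back condition gives p a neighbour of
    -- that kind; it must have value shift p + e, so k divides shift p.
    one-sided-divides : Back → ∀ {p e} → Unit e → p ≤ n → OneSided p e →
                        ∀ v w → v ≤ n → w ≤ n → v ~ p → Adj v w →
                        shift r w ≡± shift r p ℤ.- e → + k Signed.∣ shift r p
    one-sided-divides back {p} {e} u p≤n one-sided v w v≤n w≤n v~p adj w≡±p-e
      with back v p w v≤n p≤n w≤n (~-sym v~p) adj
    ... | y , y≤n , adj' , y~w =
      ≡±-one-sided u (≡±-trans {shift r y} y~w w≡±p-e) (one-sided y y≤n adj')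

    one-sided-after-hit : ∀ {x} → Hit x → OneSided (suc x) (+ 1)
    one-sided-after-hit hit y y≤n adj with adj-cases adj
    ... | inj₁ refl = inj₁ refl
    ... | inj₂ (inj₂ refl) = inj₁ (sym (shift-hit hit))
    ... | inj₂ (inj₁ refl) with hit? (suc _)
    ...   | yes hit' = inj₁ (shift-hit hit')
    ...   | no ¬hit' = inj₂ (shift-miss ¬hit')

    one-sided-end : Sparse → OneSided n (- + 1)
    one-sided-end sparse y y≤n adj with adj-cases adj
    ... | inj₁ y≡n = inj₁ (cong (shift r) y≡n)
    ... | inj₂ (inj₁ y≡1+n) = contradiction (subst (_≤ n) y≡1+n y≤n) 1+n≰n
    ... | inj₂ (inj₂ 1+y≡n) =
      inj₂ (trans (shift-miss⁻ (Sparse.last-free sparse y 1+y≡n)) (cong (λ v → shift r v ℤ.+ - + 1) 1+y≡n))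

    -- If σ x = t + 1 > 0, the
    -- last rise of σ before x goes from t at z to t + 1 at z + 1, and z + 1, z
    -- play the roles of the related point and its neighbour.
    hit-divisible : Back → ∀ {x} → Hit x → + k Signed.∣ shift r x
    hit-divisible back {x} hit with σ x in σx≡
    ... | zero  = subst (+ k Signed.∣_) (sym (value x σx≡)) (divides (+ 0) refl)
    ... | suc t with σ-ivt x (subst (t <_) (sym σx≡) ≤-refl)
    ...   | z , z<x , σz≡t , σ1+z≡1+t = subst (+ k Signed.∣_) (shift-hit hit)
      (one-sided-divides back refl 1+x≤n (one-sided-after-hit hit) (suc z) z
         1+z≤n (<⇒≤ 1+z≤n) 1+z~1+x (adj-left z) (≡±-reflexive z-value))
      where
      1+x≤n : suc x ≤ n
      1+x≤n = hit<n hit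
      1+z≤n : suc z ≤ n
      1+z≤n = ≤-trans z<x (<⇒≤ 1+x≤n)
      x-value : shift r (suc x) ≡ + suc t
      x-value = trans (shift-hit hit) (value x σx≡)
      1+z~1+x : suc z ~ suc x
      1+z~1+x = ≡±-reflexive (trans (value (suc z) σ1+z≡1+t) (sym x-value))
      z-value : shift r z ≡ shift r (suc x) ℤ.- + 1
      z-value = begin
        shift r z                 ≡⟨ value z σz≡t ⟩
        + t                       ≡⟨ one-below (+ t) ⟩
        (+ 1 ℤ.+ + t) ℤ.- + 1     ≡⟨ cong (ℤ._- + 1) x-value ⟨
        shift r (suc x) ℤ.- + 1   ∎
        where
        open ≡-Reasoning
        one-below : ∀ a → a ≡ (+ 1 ℤ.+ a) ℤ.- + 1
        one-below = solve-∀

    -- Sparseness gives u ≥ k.  If u = k we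
    -- are done; otherwise a unit step of σ from t to t + 1 with t ≡ u (when
    -- u ≥ 2k), or with t + 1 ≡ -u (when k < u < 2k), supplies a point related
    -- to n beside a value related to u + 1.
    end-divisible : Back → Sparse → 1 ≤ k → 2 * k ≤ n → + k Signed.∣ shift r n
    end-divisible back sparse 1≤k 2k≤n =
      subst (+ k Signed.∣_) (sym (shift-σ n)) (by-cases (m≤n⇒m<n∨m≡n k≤u))
      where
      u : ℕ
      u = σ n

      k≤u : k ≤ u
      k≤u = ≤-trans (σ-lower (Sparse.isolated sparse) k) (σ-mono (subst (_≤ n) (*-comm 2 k) 2k≤n))

      partner : ∀ v w → v ≤ n → w ≤ n → Adj v w → + σ v ≡± + u → + σ w ≡± + (u + 1) → + k Signed.∣ + u
      partner v w v≤n w≤n adj v≡±u w≡±u+1 = subst (+ k Signed.∣_) (shift-σ n)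
        (one-sided-divides back refl ≤-refl (one-sided-end sparse) v w v≤n w≤n v~n adj w≡±n+1)
        where
        v~n : v ~ n
        v~n = subst₂ _≡±_ (sym (shift-σ v)) (sym (shift-σ n)) v≡±u
        w≡±n+1 : shift r w ≡± shift r n ℤ.+ + 1
        w≡±n+1 = subst₂ _≡±_ (sym (shift-σ w)) (cong (ℤ._+ + 1) (sym (shift-σ n))) w≡±u+1

      0<2k : 0 < 2 * k
      0<2k = ≤-trans 1≤k (m≤m+n k (k + 0))

      -- u = t + 2k: the step from t to t + 1
      apart : ∀ t → t + 2 * k ≡ u → + k Signed.∣ + u
      apart t t+2k≡u with σ-ivt n (subst (t <_) t+2k≡u (m<m+n t 0<2k))
      ... | z , z<n , σz≡t , σ1+z≡1+t = partner z (suc z) (<⇒≤ z<n) z<n (adj-right z)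
        (subst (λ s → + s ≡± + u) (sym σz≡t) (≡±-apart {t} {u} t+2k≡u))
        (subst (λ s → + s ≡± + (u + 1)) (sym σ1+z≡1+t)
               (≡±-apart {suc t} {u + 1} (trans (cong suc t+2k≡u) (+-comm 1 u))))

      -- t + 1 + u = 2k with k < u: the step from t to t + 1
      mirror-below : ∀ t → t + suc u ≡ 2 * k → k < u → t < u
      mirror-below t t+1+u≡2k k<u = +-cancelʳ-≤ u (suc t) u (begin
        suc t + u ≡⟨ +-suc t u ⟨
        t + suc u ≡⟨ t+1+u≡2k ⟩
        2 * k     ≤⟨ *-monoʳ-≤ 2 (<⇒≤ k<u) ⟩
        2 * u     ≡⟨ cong (λ v → u + v) (+-identityʳ u) ⟩
        u + u     ∎)
        where open ≤-Reasoning

      mirrored : ∀ t → t + suc u ≡ 2 * k → k < u → + k Signed.∣ + u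
      mirrored t t+1+u≡2k k<u with σ-ivt n (mirror-below t t+1+u≡2k k<u)
      ... | z , z<n , σz≡t , σ1+z≡1+t = partner (suc z) z z<n (<⇒≤ z<n) (adj-left z)
        (subst (λ s → + s ≡± + u) (sym σ1+z≡1+t) (≡±-mirror {suc t} {u} (trans (sym (+-suc t u)) t+1+u≡2k)))
        (subst (λ s → + s ≡± + (u + 1)) (sym σz≡t)
               (≡±-mirror {t} {u + 1} (trans (cong (λ v → t + v) (+-comm u 1)) t+1+u≡2k)))

      by-cases : k < u ⊎ k ≡ u → + k Signed.∣ + u
      by-cases (inj₂ k≡u) = subst (λ v → + k Signed.∣ + v) k≡u Signed.∣-refl
      by-cases (inj₁ k<u) with u <? 2 * k
      ... | yes u<2k = mirrored (2 * k ∸ suc u) (m∸n+n≡m u<2k) k<u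
      ... | no u≮2k  = apart (u ∸ 2 * k) (m∸n+n≡m (≮⇒≥ u≮2k))

    Move : ℕ → ℤ → Set
    Move x e = Σ ℕ λ y → y ≤ n × Adj x y × shift r y ≡ shift r x ℤ.+ e

    move-right : ∀ {x} → suc x ≤ n → ¬ Hit x → Move x (+ 1)
    move-right {x} 1+x≤n ¬hit = suc x , 1+x≤n , adj-right x , shift-miss ¬hit

    move-left : ∀ {y} → suc y ≤ n → ¬ Hit y → Move (suc y) (- + 1)
    move-left {y} 1+y≤n ¬hit = y , <⇒≤ 1+y≤n , adj-left y , shift-miss⁻ ¬hit

    -- Under (1)-(3) every point can move up by one, or else it can move down by
    -- one and k divides its value (so that down and up are related).
    module Moves (sparse : Sparse) (1≤n : 1 ≤ n)
                 (hit-div : ∀ x → Hit x → + k Signed.∣ shift r x)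
                 (end-div : + k Signed.∣ shift r n) where
      open Sparse sparse

      up-or-balanced : ∀ x → x ≤ n → Move x (+ 1) ⊎ (Move x (- + 1) × + k Signed.∣ shift r x)
      up-or-balanced zero _ = inj₁ (move-right 1≤n first-free)
      up-or-balanced (suc y) 1+y≤n with hit? (suc y)
      ... | yes hit = inj₂ (move-left 1+y≤n (λ hit' → isolated y hit' hit) , hit-div (suc y) hit)
      ... | no ¬hit with suc y <? n
      ...   | yes 1+y<n = inj₁ (move-right 1+y<n ¬hit)
      ...   | no 1+y≮n = inj₂ (move-left 1+y≤n (last-free y 1+y≡n) ,
                               subst (λ v → + k Signed.∣ shift r v) (sym 1+y≡n) end-div)
        where
        1+y≡n : suc y ≡ n
        1+y≡n = ≤-antisym 1+y≤n (≮⇒≥ 1+y≮n)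

      down-or-balanced : ∀ x → x ≤ n → Move x (- + 1) ⊎ (Move x (+ 1) × + k Signed.∣ shift r x)
      down-or-balanced zero _ =
        inj₂ (move-right 1≤n first-free , subst (+ k Signed.∣_) (sym shift-zero) (divides (+ 0) refl))
      down-or-balanced (suc y) 1+y≤n with hit? y
      ... | no ¬hit = inj₁ (move-left 1+y≤n ¬hit)
      ... | yes hit = inj₂ (move-right 2+y≤n (isolated y hit) ,
                            subst (+ k Signed.∣_) (sym (shift-hit hit)) (hit-div y hit))
        where
        2+y≤n : suc (suc y) ≤ n
        2+y≤n = ≤∧≢⇒< 1+y≤n (λ 1+y≡n → last-free y 1+y≡n hit)

      reach : ∀ {x e} → x ≤ n → Unit e → Σ ℕ λ y → y ≤ n × Adj x y × shift r y ≡± shift r x ℤ.+ e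
      reach {x} {+ 1} x≤n _ with up-or-balanced x x≤n
      ... | inj₁ (y , y≤n , adj , up) = y , y≤n , adj , ≡±-reflexive up
      ... | inj₂ ((y , y≤n , adj , down) , k∣x) =
        y , y≤n , adj , ≡±-trans (≡±-reflexive down) (≡±-sym (∣⇒±unit (+ 1) k∣x))
      reach {x} { -[1+ 0 ]} x≤n _ with down-or-balanced x x≤n
      ... | inj₁ (y , y≤n , adj , down) = y , y≤n , adj , ≡±-reflexive down
      ... | inj₂ ((y , y≤n , adj , up) , k∣x) =
        y , y≤n , adj , ≡±-trans (≡±-reflexive up) (∣⇒±unit (+ 1) k∣x)
      reach {e = + 0} _ ()
      reach {e = + suc (suc _)} _ ()
      reach {e = -[1+ suc _ ]} _ ()

      -- The back condition: move x' by the same step as x → y, or by the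
      -- opposite step when x' carries the negated value.
      back : Back
      back x x' y x≤n x'≤n y≤n x'~x adj with step-value adj
      ... | inj₁ unchanged = x' , x'≤n , adj-refl x' , ~-trans x'~x (≡±-reflexive (sym unchanged))
      ... | inj₂ (e , u , y-value) = towards (≡±-translate e x'~x)
        where
        Target : Set
        Target = Σ ℕ λ y' → y' ≤ n × Adj x' y' × y' ~ y
        via : ∀ {d} → Σ ℕ (λ y' → y' ≤ n × Adj x' y' × shift r y' ≡± shift r x' ℤ.+ d) →
              shift r x' ℤ.+ d ≡± shift r x ℤ.+ e → Target
        via (y' , y'≤n , adj' , y'≡±) x'+d≡±x+e =
          y' , y'≤n , adj' , ≡±-trans y'≡± (≡±-trans x'+d≡±x+e (≡±-reflexive (sym y-value)))
        towards : (shift r x' ℤ.+ e ≡± shift r x ℤ.+ e) ⊎ (shift r x' ℤ.- e ≡± shift r x ℤ.+ e) → Target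
        towards (inj₁ shifted) = via (reach x'≤n u) shifted
        towards (inj₂ flipped) = via (reach x'≤n (unit-neg {e} u)) flipped

      -- The points 0 and 1 have values 0 and 1, which are never related.
      two-classes : MoreThanOneClass n (kr n k r)
      two-classes with as-point 1≤n
      ... | b , b≡1 = fzero , b , λ 0θb →
        ≢±-adjacent {+ 0} {+ 1} refl (subst₂ _≡±_ shift-zero 1-value (kr⇒~ {fzero} {b} 0θb))
        where
        1-value : shift r (toℕ b) ≡ + 0 ℤ.+ + 1
        1-value = trans (cong (shift r) b≡1) (trans (shift-miss first-free) (cong (ℤ._+ + 1) shift-zero))

lemma2p6 : (n m k : ℕ) (r : Fin m → ℕ) →
    3 ≤ n → StrictlyIncreasing r → (∀ i → r i < n) →
    1 ≤ k → 2 * k ≤ n →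
    ((IsCongruence n (kr n k r) × MoreThanOneClass n (kr n k r))
      ⇔ (Cond1 n r × Cond2 k r × Cond3 n k m))
lemma2p6 n m k r 3≤n inc r<n 1≤k 2k≤n = mk⇔ necessary sufficient
  where
  open Line n r inc r<n
  open Relation k

  necessary : IsCongruence n (kr n k r) × MoreThanOneClass n (kr n k r) →
              Cond1 n r × Cond2 k r × Cond3 n k m
  necessary (congruence , split) =
    sparse⇒cond1 sparse ,
    hits-divisible⇒cond2 (λ _ → hit-divisible back) ,
    end-divisible⇒cond3 (end-divisible back sparse 1≤k 2k≤n)
    where
    back : Back
    back = congruence⇒back congruence
    sparse : Sparse
    sparse = sparse-hits back split

  sufficient : Cond1 n r × Cond2 k r × Cond3 n k m →
               IsCongruence n (kr n k r) × MoreThanOneClass n (kr n k r)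
  sufficient (c1 , c2 , c3) = back⇒congruence back , two-classes
    where
    open Moves (cond1⇒sparse c1) (≤-trans (s≤s z≤n) 3≤n)
               (cond2⇒hits-divisible c2) (cond3⇒end-divisible c3)
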